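{- Let $\mathbf{L}=\langle L,\leq\rangle$ be a complete lattice and $S$ an $L$-parameterization. An operator $C\colon L\to L$ is an $S$-closure operator in $\mathbf{L}$ if and only if it satisfies $a\leq C(a)$ and $C(C(a))\leq C(a)$ for all $a\in L$, and, for all $a,b\in L$ and all $\langle f,h\rangle\in S$, $a\leq h(b)$ implies $C(a)\leq h(C(b))$.
   Context: An isotone Galois connection in $\mathbf{L}$ is a pair $\langle f,h\rangle$ of maps $L\to L$ with $f(a)\leq b$ iff $a\leq h(b)$. An $L$-parameterization is a set $S$ of isotone Galois connections containing $\langle\mathrm{id},\mathrm{id}\rangle$. An $S$-closure operator is $C\colon L\to L$ with $a\leq C(a)$, $a\leq b$ implies $C(a)\leq C(b)$, and $C(h(C(a)))\leq h(C(a))$ for all $a,b\in L$ and $\langle f,h\rangle\in S$. -}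

module Defs where

open import Level using (Level; suc; _⊔_)
open import Data.Product using (_×_; _,_; proj₁; proj₂)
open import Function using (id)
open import Relation.Unary using (Pred; _∈_)
open import Relation.Binary.Bundles using (Poset)
open import Relation.Binary.PropositionalEquality using (_≡_)

record CompleteLattice (c ℓ₁ ℓ₂ : Level) : Set (suc (c ⊔ ℓ₁ ⊔ ℓ₂)) where
  field
    poset : Poset c ℓ₁ ℓ₂
  open Poset poset public
  field
    ⋁     : Pred Carrier ℓ₂ → Carrier
    ⋁-ub  : (X : Pred Carrier ℓ₂) → ∀ {x} → x ∈ X → x ≤ ⋁ X
    ⋁-lub : (X : Pred Carrier ℓ₂) → ∀ {y} → (∀ {x} → x ∈ X → x ≤ y) → ⋁ X ≤ y

module _ {c ℓ₁ ℓ₂ : Level} (𝐋 : CompleteLattice c ℓ₁ ℓ₂) where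
  open CompleteLattice 𝐋

  Pair : Set c
  Pair = (Carrier → Carrier) × (Carrier → Carrier)

  IsIsotoneGalois : Pair → Set (c ⊔ ℓ₂)
  IsIsotoneGalois (f , h) =
    ∀ a b → (f a ≤ b → a ≤ h b) × (a ≤ h b → f a ≤ b)

  record IsParameterization {s : Level} (S : Pred Pair s) : Set (c ⊔ ℓ₂ ⊔ s) where
    field
      galois : ∀ {p} → p ∈ S → IsIsotoneGalois p
      has-id : (id , id) ∈ S

  IsSClosure : {s : Level} → Pred Pair s → (Carrier → Carrier) → Set (c ⊔ ℓ₂ ⊔ s)
  IsSClosure S C =
      (∀ a → a ≤ C a)
    × (∀ a b → a ≤ b → C a ≤ C b)
    × (∀ a {f h} → (f , h) ∈ S → C (h (C a)) ≤ h (C a))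

  IsSClosureAlt : {s : Level} → Pred Pair s → (Carrier → Carrier) → Set (c ⊔ ℓ₂ ⊔ s)
  IsSClosureAlt S C =
      (∀ a → a ≤ C a)
    × (∀ a → C (C a) ≤ C a)
    × (∀ a b {f h} → (f , h) ∈ S → a ≤ h b → C a ≤ h (C b))

module Submission where

open import Defs
open import Level using (Level)
open import Data.Product using (_×_; _,_; proj₁; proj₂)
open import Relation.Unary using (Pred; _∈_)

-- Forwards, C a ≤ C (h (C b)) ≤ h (C b) by monotonicity and the S-closure law;
-- the idempotence law is that law for ⟨id , id⟩. Backwards, monotonicity is the
-- new law for ⟨id , id⟩, and the S-closure law follows from h (C a) ≤ h (C a)
-- together with idempotence.

module _ {c ℓ₁ ℓ₂ : Level} (𝐋 : CompleteLattice c ℓ₁ ℓ₂) where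
  open CompleteLattice 𝐋

  upper-adjoint-mono : ∀ {f h} → IsIsotoneGalois 𝐋 (f , h) →
                       ∀ {x y} → x ≤ y → h x ≤ h y
  upper-adjoint-mono {h = h} gc {x} {y} x≤y =
    proj₁ (gc (h x) y) (trans (proj₂ (gc (h x) x) refl) x≤y)

  module _ {s : Level} {S : Pred (Pair 𝐋) s} (P : IsParameterization 𝐋 S)
           {C : Carrier → Carrier} where
    open IsParameterization P

    SClosure⇒SClosureAlt : IsSClosure 𝐋 S C → IsSClosureAlt 𝐋 S C
    SClosure⇒SClosureAlt (extensive , mono , closed) =
      extensive , idempotent , transfer
      where
      idempotent : ∀ a → C (C a) ≤ C a
      idempotent a = closed a has-id

      transfer : ∀ a b {f h} → (f , h) ∈ S → a ≤ h b → C a ≤ h (C b)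
      transfer a b p a≤hb = trans
        (mono a _ (trans a≤hb (upper-adjoint-mono (galois p) (extensive b))))
        (closed b p)

    SClosureAlt⇒SClosure : IsSClosureAlt 𝐋 S C → IsSClosure 𝐋 S C
    SClosureAlt⇒SClosure (extensive , idempotent , transfer) =
      extensive , mono , closed
      where
      mono : ∀ a b → a ≤ b → C a ≤ C b
      mono a b = transfer a b has-id

      closed : ∀ a {f h} → (f , h) ∈ S → C (h (C a)) ≤ h (C a)
      closed a p = trans (transfer _ (C a) p refl)
                         (upper-adjoint-mono (galois p) (idempotent a))

theorem33 : {c ℓ₁ ℓ₂ s : Level} (𝐋 : CompleteLattice c ℓ₁ ℓ₂)
    (S : Pred (Pair 𝐋) s) → IsParameterization 𝐋 S →
    (C : CompleteLattice.Carrier 𝐋 → CompleteLattice.Carrier 𝐋) →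
    (IsSClosure 𝐋 S C → IsSClosureAlt 𝐋 S C) × (IsSClosureAlt 𝐋 S C → IsSClosure 𝐋 S C)
theorem33 𝐋 S P C = SClosure⇒SClosureAlt 𝐋 P , SClosureAlt⇒SClosure 𝐋 P
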